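{- Let $S\in\{0,1\}^\omega$. (1) If $\rho_{\mathrm{PD}}(S)=1$, then $S$ is not PD-deep. (2) If $R_{\mathrm{UPD}}(S)=0$, then $S$ is not PD-deep.
   Context: A pushdown compressor (PDC) is a tuple $C=(Q,\Gamma,\delta,\nu,q_0,z_0,c)$ with $Q$ a finite nonempty set of states, stack alphabet $\Gamma=\{0,1,z_0\}$, partial transition function $\delta:Q\times(\{0,1\}\cup\{\lambda\})\times\Gamma\to Q\times\Gamma^*$, output function $\nu:Q\times(\{0,1\}\cup\{\lambda\})\times\Gamma\to\{0,1\}^*$, initial state $q_0$, bottom-of-stack symbol $z_0$, and $c\in\mathbb N$. A transition $\delta(q,b,a)=(q',w)$ replaces the top stack symbol $a$ by $w$; $z_0$ can never be removed (if $a=z_0$ then $w$ ends in $z_0$). $\lambda$-transitions read no input and pop the top symbol; for each $q,a$, either $\delta(q,\lambda,a)$ is undefined or $\delta(q,b,a)$ is undefined for both $b\in\{0,1\}$ (determinism), and at most $c$ consecutive $\lambda$-transitions can occur without reading an input bit. After each input bit, $\lambda$-transitions are applied while defined. $\lambda$-transitions output $\lambda$; the output $C(w)$ is the concatenation of the outputs of the transitions on input $w$ starting from $q_0$ with stack $z_0$, and $\delta_Q(w)$ is the final state. $C$ is information lossless (ILPDC) if $w\mapsto(C(w),\delta_Q(w))$ is injective. A unary-stack PDC (UPDC) is the same but with $\Gamma=\{0,z_0\}$; an ILUPDC is an information lossless UPDC. For $S\in\{0,1\}^\omega$ and a compressor $C$: $\rho_C(S)=\liminf_n|C(S\upharpoonright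 n)|/n$, $R_C(S)=\limsup_n|C(S\upharpoonright n)|/n$; $\rho_{\mathrm{PD}}(S)=\inf\{\rho_C(S):C\in\mathrm{ILPDC}\}$, $R_{\mathrm{UPD}}(S)=\inf\{R_C(S):C\in\mathrm{ILUPDC}\}$. $S$ is PD-deep if there is $\alpha>0$ such that for every ILUPDC $C$ there is an ILPDC $C'$ with $|C(S\upharpoonright n)|-|C'(S\upharpoonright n)|\ge\alpha n$ for all but finitely many $n$. -}

module Defs where

open import Data.Nat using (ℕ; zero; suc; _≥_)
open import Data.Bool using (Bool; true; false)
open import Data.Fin using (Fin)
open import Data.List using (List; []; _∷_; _++_; length)
open import Data.Maybe using (Maybe; just; nothing)
open import Data.Product using (Σ; _×_; _,_; proj₁; proj₂; ∃-syntax)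
open import Data.Sum using (_⊎_)
open import Data.Empty using (⊥)
open import Relation.Nullary using (¬_)
open import Relation.Binary.PropositionalEquality using (_≡_; _≢_; refl)
open import Data.Integer using (ℤ; +_)
open import Data.Rational using (ℚ; _/_; _≤_; _<_; _+_; _*_; _-_; 0ℚ; 1ℚ)

data Sym : Set where
  s0 s1 z0 : Sym

data USym : Set where
  u0 uz0 : USym

-- Pushdown compressors over a stack alphabet Γ with bottom symbol z.
-- States: Fin (suc k)  (finite, nonempty).  Input symbol: just b  for a
-- bit b, nothing for λ.

record PDC (Γ : Set) (z : Γ) : Set where
  field
    k  : ℕ
    δ  : Fin (suc k) → Maybe Bool → Γ → Maybe (Fin (suc k) × List Γ)
    ν  : Fin (suc k) → Maybe Bool → Γ → List Bool
    q₀ : Fin (suc k)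
    c  : ℕ

module _ {Γ : Set} {z : Γ} (C : PDC Γ z) where
  open PDC C

  -- configuration: state, stack (head = top), output so far
  Config : Set
  Config = Fin (suc k) × List Γ × List Bool

  initConfig : Config
  initConfig = q₀ , (z ∷ []) , []

  -- apply λ-transitions while defined, at most c of them; fails (nothing)
  -- if a further λ-transition is still defined after c of them.
  lamClose : ℕ → Config → Maybe Config
  lamClose n (q , [] , o) = just (q , [] , o)
  lamClose zero (q , a ∷ s , o) with δ q nothing a
  ... | nothing = just (q , a ∷ s , o)
  ... | just _  = nothing
  lamClose (suc n) (q , a ∷ s , o) with δ q nothing a
  ... | nothing        = just (q , a ∷ s , o)
  ... | just (q' , w)  = lamClose n (q' , w ++ s , o ++ ν q nothing a)

  readBit : Bool → Config → Maybe Config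
  readBit b (q , [] , o) = nothing
  readBit b (q , a ∷ s , o) with δ q (just b) a
  ... | nothing       = nothing
  ... | just (q' , w) = lamClose c (q' , w ++ s , o ++ ν q (just b) a)

  runFrom : Config → List Bool → Maybe Config
  runFrom cfg []       = just cfg
  runFrom cfg (b ∷ bs) with readBit b cfg
  ... | nothing   = nothing
  ... | just cfg' = runFrom cfg' bs

  -- run on input w from q₀ with stack z0 (nothing = computation undefined)
  run : List Bool → Maybe Config
  run = runFrom initConfig

  record WellFormed : Set where
    field
      -- z0 can never be removed
      bottom  : ∀ q b a q' w → δ q b a ≡ just (q' , w) → a ≡ z →
                ∃[ w' ] (w ≡ w' ++ (z ∷ []))
      lamPop  : ∀ q a q' w → δ q nothing a ≡ just (q' , w) → w ≡ []
      lamOut  : ∀ q a → ν q nothing a ≡ []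
      det     : ∀ q a → δ q nothing a ≡ nothing ⊎
                        (δ q (just false) a ≡ nothing × δ q (just true) a ≡ nothing)
      -- the computation is defined on every input (in particular at most
      -- c consecutive λ-transitions ever occur)
      total   : ∀ w → run w ≢ nothing

  result : (w : List Bool) → run w ≢ nothing → Config
  result w h with run w
  ... | just cfg = cfg
  ... | nothing  with h refl
  ...   | ()

record ILComp (Γ : Set) (z : Γ) : Set where
  field
    machine : PDC Γ z
    wf      : WellFormed machine
  open WellFormed wf
  out : List Bool → List Bool
  out w = proj₂ (proj₂ (result machine w (total w)))
  finalState : List Bool → Fin (suc (PDC.k machine))
  finalState w = proj₁ (result machine w (total w))
  field
    lossless : ∀ w w' → out w ≡ out w' → finalState w ≡ finalState w' → w ≡ w'

ILPDC : Set
ILPDC = ILComp Sym z0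

ILUPDC : Set
ILUPDC = ILComp USym uz0

Seq : Set
Seq = ℕ → Bool

prefix : Seq → ℕ → List Bool
prefix S zero    = []
prefix S (suc n) = prefix S n ++ (S n ∷ [])

compLen : ∀ {Γ z} → ILComp Γ z → Seq → ℕ → ℕ
compLen C S n = length (ILComp.out C (prefix S n))

toℚ : ℕ → ℚ
toℚ n = (+ n) / 1

LiminfGe : (ℕ → ℕ) → ℚ → Set
LiminfGe f r = ∀ ε → 0ℚ < ε → ∃[ N ] ∀ n → n ≥ N → (r - ε) * toℚ n ≤ toℚ (f n)

LiminfLe : (ℕ → ℕ) → ℚ → Set
LiminfLe f r = ∀ ε → 0ℚ < ε → ∀ N → ∃[ n ] (n ≥ N × toℚ (f n) ≤ (r + ε) * toℚ n)

LimsupLe : (ℕ → ℕ) → ℚ → Set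
LimsupLe f r = ∀ ε → 0ℚ < ε → ∃[ N ] ∀ n → n ≥ N → toℚ (f n) ≤ (r + ε) * toℚ n

ρPD≡1 : Seq → Set
ρPD≡1 S = (∀ (C : ILPDC) → LiminfGe (compLen C S) 1ℚ)
        × (∀ ε → 0ℚ < ε → ∃[ C ] LiminfLe (compLen {Sym} {z0} C S) (1ℚ + ε))

-- R_UPD(S) = 0 : inf over ILUPDC C of R_C(S) equals 0 (R_C(S) ≥ 0 always)
RUPD≡0 : Seq → Set
RUPD≡0 S = ∀ ε → 0ℚ < ε → ∃[ C ] LimsupLe (compLen {USym} {uz0} C S) ε

PDDeep : Seq → Set
PDDeep S = ∃[ α ] (0ℚ < α × ∀ (C : ILUPDC) → ∃[ C' ] ∃[ N ] ∀ n → n ≥ N →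
  toℚ (compLen {Sym} {z0} C' S n) + α * toℚ n ≤ toℚ (compLen C S n))

-- The identity map is an information lossless unary-stack compressor with output length exactly n.
-- (1) If ρ_PD(S) = 1, no ILPDC saves a linear amount αn over the identity compressor, since it
-- outputs at least (1 - α/2)n bits eventually. (2) If R_UPD(S) = 0, some ILUPDC outputs at most
-- (α/2)n bits eventually, and no output length can be αn shorter than that.
module Submission where

open import Defs
open import Data.Product using (_×_)
open import Relation.Nullary using (¬_)

open import Data.Nat as ℕ using (ℕ; zero; suc; _⊔_)
open import Data.Nat.Properties as ℕ using (m≤m⊔n; m≤n⊔m; n≤1+n)
open import Data.Bool using (Bool)
open import Data.Fin using (Fin)
open import Data.List using (List; []; _∷_; _++_; length)
open import Data.List.Properties using (++-assoc; ++-identityʳ; length-++)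
open import Data.Maybe using (Maybe; just; nothing)
open import Data.Product using (_,_; proj₂; ∃-syntax)
open import Data.Sum using (inj₁)
open import Relation.Binary.PropositionalEquality using (_≡_; _≢_; refl; sym; trans; cong; subst)
open import Data.Rational using (ℚ; _≤_; _<_; _+_; _*_; _-_; 0ℚ; 1ℚ; ½; Positive; positive)
open import Data.Rational.Properties as ℚ using ()
open import Data.Rational.Solver using (module +-*-Solver)

Eventually : (ℕ → Set) → Set
Eventually P = ∃[ N ] ∀ n → n ℕ.≥ N → P n

eventually-× : {P Q : ℕ → Set} → Eventually P → Eventually Q → Eventually (λ n → P n × Q n)
eventually-× (M , p) (N , q) = M ⊔ N , λ n n≥ →
  p n (ℕ.≤-trans (m≤m⊔n M N) n≥) , q n (ℕ.≤-trans (m≤n⊔m M N) n≥)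

eventually⇒∃suc : {P : ℕ → Set} → Eventually P → ∃[ m ] P (suc m)
eventually⇒∃suc (N , p) = N , p (suc N) (n≤1+n N)

result≡ : ∀ {Γ z} (C : PDC Γ z) w h {cfg} → run C w ≡ just cfg → result C w h ≡ cfg
result≡ C w h eq with run C w
result≡ C w h refl | just _ = refl

length-prefix : ∀ S n → length (prefix S n) ≡ n
length-prefix S zero    = refl
length-prefix S (suc n) =
  trans (length-++ (prefix S n)) (trans (cong (ℕ._+ 1) (length-prefix S n)) (ℕ.+-comm n 1))

module IdentityCompressor where

  δ : Fin 1 → Maybe Bool → USym → Maybe (Fin 1 × List USym)
  δ q (just b) uz0 = just (q , uz0 ∷ [])
  δ q _        _   = nothing

  ν : Fin 1 → Maybe Bool → USym → List Bool
  ν q (just b) a = b ∷ []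
  ν q nothing  a = []

  machine : PDC USym uz0
  machine = record { k = 0 ; δ = δ ; ν = ν ; q₀ = Fin.zero ; c = 0 }

  runFrom-copies : ∀ q o w → runFrom machine (q , uz0 ∷ [] , o) w ≡ just (q , uz0 ∷ [] , o ++ w)
  runFrom-copies q o []      = cong (λ o′ → just (q , uz0 ∷ [] , o′)) (sym (++-identityʳ o))
  runFrom-copies q o (b ∷ w) = trans (runFrom-copies q (o ++ b ∷ []) w)
    (cong (λ o′ → just (q , uz0 ∷ [] , o′)) (++-assoc o (b ∷ []) w))

  run-copies : ∀ w → run machine w ≡ just (Fin.zero , uz0 ∷ [] , w)
  run-copies = runFrom-copies Fin.zero []

  bottom : ∀ q b a q′ w → δ q b a ≡ just (q′ , w) → a ≡ uz0 → ∃[ w′ ] (w ≡ w′ ++ (uz0 ∷ []))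
  bottom q (just b) uz0 q′ w refl _ = [] , refl

  wellFormed : WellFormed machine
  wellFormed = record
    { bottom = bottom
    ; lamPop = λ { q a q′ w () }
    ; lamOut = λ q a → refl
    ; det    = λ q a → inj₁ refl
    ; total  = λ w run≡nothing → just≢nothing (trans (sym (run-copies w)) run≡nothing)
    }
    where
    just≢nothing : ∀ {x : Config machine} → just x ≢ nothing
    just≢nothing ()

  out-copies : ∀ w → proj₂ (proj₂ (result machine w (WellFormed.total wellFormed w))) ≡ w
  out-copies w = cong (λ cfg → proj₂ (proj₂ cfg)) (result≡ machine w _ (run-copies w))

  compressor : ILUPDC
  compressor = record
    { machine  = machine
    ; wf       = wellFormed
    ; lossless = λ w w′ eq _ → trans (sym (out-copies w)) (trans eq (out-copies w′))
    }

  compLen-compressor : ∀ S n → compLen compressor S n ≡ n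
  compLen-compressor S n = trans (cong length (out-copies (prefix S n))) (length-prefix S n)

open +-*-Solver using (solve; _:+_; _:-_; _:*_; _:=_; con)

<+pos : ∀ z p .{{_ : Positive p}} → z < z + p
<+pos z p = subst (_< z + p) (ℚ.+-identityʳ z) (ℚ.+-monoʳ-< z (ℚ.positive⁻¹ p))

half-pos : ∀ α .{{_ : Positive α}} x .{{_ : Positive x}} → Positive (α * ½ * x)
half-pos α x = ℚ.pos*pos⇒pos (α * ½) {{ℚ.pos*pos⇒pos α ½}} x

toℚ-suc-pos : ∀ m → Positive (toℚ (suc m))
toℚ-suc-pos m = ℚ.normalize-pos (suc m) 1

toℚ-nonNeg : ∀ m → 0ℚ ≤ toℚ m
toℚ-nonNeg zero    = ℚ.≤-refl
toℚ-nonNeg (suc m) = ℚ.<⇒≤ (ℚ.positive⁻¹ _ {{toℚ-suc-pos m}})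

module _ (α x : ℚ) .{{α-pos : Positive α}} .{{x-pos : Positive x}} where
  open ℚ.≤-Reasoning

  saving-contradicts-lowerBound : ∀ {y} → (1ℚ - α * ½) * x ≤ y → ¬ (y + α * x ≤ x)
  saving-contradicts-lowerBound {y} lower saving = ℚ.<-irrefl refl (begin-strict
    x                        <⟨ <+pos x (α * ½ * x) {{half-pos α x}} ⟩
    x + α * ½ * x            ≡⟨ regroup α x ⟩
    (1ℚ - α * ½) * x + α * x ≤⟨ ℚ.+-monoˡ-≤ (α * x) lower ⟩
    y + α * x                ≤⟨ saving ⟩
    x                        ∎)
    where
    regroup : ∀ a x → x + a * ½ * x ≡ (1ℚ - a * ½) * x + a * x
    regroup = solve 2 (λ a x → x :+ a :* con ½ :* x := (con 1ℚ :- a :* con ½) :* x :+ a :* x) refl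

  -- The bound is the limsup guarantee with both the target rate and the margin ε set to α/4.
  saving-contradicts-upperBound : ∀ {y y′} → 0ℚ ≤ y′ → y ≤ (α * ½ * ½ + α * ½ * ½) * x →
                                  ¬ (y′ + α * x ≤ y)
  saving-contradicts-upperBound {y} {y′} y′≥0 upper saving = ℚ.<-irrefl refl (begin-strict
    (α * ½ * ½ + α * ½ * ½) * x             <⟨ <+pos _ (α * ½ * x) {{half-pos α x}} ⟩
    (α * ½ * ½ + α * ½ * ½) * x + α * ½ * x ≡⟨ regroup α x ⟩
    0ℚ + α * x                              ≤⟨ ℚ.+-monoˡ-≤ (α * x) y′≥0 ⟩
    y′ + α * x                              ≤⟨ saving ⟩
    y                                       ≤⟨ upper ⟩
    (α * ½ * ½ + α * ½ * ½) * x             ∎)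
    where
    regroup : ∀ a x → (a * ½ * ½ + a * ½ * ½) * x + a * ½ * x ≡ 0ℚ + a * x
    regroup = solve 2 (λ a x → (a :* con ½ :* con ½ :+ a :* con ½ :* con ½) :* x :+ a :* con ½ :* x
                               := con 0ℚ :+ a :* x) refl

ρPD≡1⇒¬PDDeep : ∀ S → ρPD≡1 S → ¬ PDDeep S
ρPD≡1⇒¬PDDeep S (incompressible , _) (α , α>0 , deep) =
  let C′ , saving       = deep IdentityCompressor.compressor
      m , lower , saves = eventually⇒∃suc
                            (eventually-× (incompressible C′ (α * ½) (ℚ.positive⁻¹ _)) saving)
  in saving-contradicts-lowerBound α (toℚ (suc m)) {{x-pos = toℚ-suc-pos m}} lower
       (ℚ.≤-trans saves (ℚ.≤-reflexive (cong toℚ (IdentityCompressor.compLen-compressor S (suc m)))))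
  where instance
  α-pos : Positive α
  α-pos = positive α>0
  α½-pos : Positive (α * ½)
  α½-pos = ℚ.pos*pos⇒pos α ½

RUPD≡0⇒¬PDDeep : ∀ S → RUPD≡0 S → ¬ PDDeep S
RUPD≡0⇒¬PDDeep S compressible (α , α>0 , deep) =
  let C , compresses    = compressible (α * ½ * ½) (ℚ.positive⁻¹ _)
      C′ , saving       = deep C
      m , saves , upper = eventually⇒∃suc
                            (eventually-× saving (compresses (α * ½ * ½) (ℚ.positive⁻¹ _)))
  in saving-contradicts-upperBound α (toℚ (suc m)) {{x-pos = toℚ-suc-pos m}}
       (toℚ-nonNeg (compLen C′ S (suc m))) upper saves
  where instance
  α-pos : Positive α
  α-pos = positive α>0
  α¼-pos : Positive (α * ½ * ½)
  α¼-pos = ℚ.pos*pos⇒pos (α * ½) {{ℚ.pos*pos⇒pos α ½}} ½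

theorem2 : (S : Seq) → (ρPD≡1 S → ¬ PDDeep S) × (RUPD≡0 S → ¬ PDDeep S)
theorem2 S = ρPD≡1⇒¬PDDeep S , RUPD≡0⇒¬PDDeep S
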